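{- Let $S$ be a monoid with zero $0$ and a quaternary operation $(s=t)[u,v]$ satisfying all axioms of a weak comparison monoid except possibly the quasi-identity "$(s*t)\le\mathsf e$ and $(s\neq t)\le\mathsf e$ imply $D(s)D(t)\le\mathsf e$". Then that quasi-identity holds (for all $s,t\in S$, $\mathsf e\in D(S)$) if and only if the identities $$(s=t)[u,u]=D(s)D(t)u\quad\text{and}\quad (s=t)[u,v]=(s=t)[(s*t)u,\,(s\neq t)v]$$ hold for all $s,t,u,v\in S$.
   Context: Here $s*t:=(s=t)[1,0]$, $(s\neq t):=(s=t)[0,1]$, $D(s):=s*s$, $D(S)=\{D(s)\mid s\in S\}$, and $\mathsf e\le\mathsf f$ means $\mathsf e=\mathsf e\mathsf f$. The axioms of a weak comparison monoid (other than the quasi-identity in question) are: for all $s,t,u,v\in S$ and $\mathsf e\in D(S)$: $(s*s)s=s$; $s*t=t*s$; $(s*t)s=(s*t)t$; $((u*v)s)*t=(s*t)(u*v)$; $u(s*t)=(us*ut)u$; $D(s\neq t)=(s\neq t)$; $s(t\neq u)=(st\neq su)s$; $(s*t)(s\neq t)=0$; $\mathsf e(u\neq v)=(\mathsf e u\neq\mathsf e v)$; $(s*t)\,(s=t)[u,v]=(s*t)u$; $(s\neq t)\,(s=t)[u,v]=(s\neq t)v$; $D((s=t)[u,v])\le D(s)D(t)$. -}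

module Defs where

open import Level using (Level; suc; _⊔_)
open import Relation.Binary.PropositionalEquality using (_≡_)
open import Data.Product using (_×_)

record PreWCM (ℓ : Level) : Set (suc ℓ) where
  infixl 7 _·_
  field
    S   : Set ℓ
    _·_ : S → S → S
    𝟙   : S
    𝟘   : S
    cmp : S → S → S → S → S      -- cmp s t u v  =  (s = t)[u , v]

  _✱_ : S → S → S
  s ✱ t = cmp s t 𝟙 𝟘
  _≢ₛ_ : S → S → S
  s ≢ₛ t = cmp s t 𝟘 𝟙
  D : S → S
  D s = s ✱ s
  _≼_ : S → S → Set ℓ
  e ≼ f = e ≡ e · f

  field
    assoc   : ∀ x y z → (x · y) · z ≡ x · (y · z)
    identityˡ : ∀ x → 𝟙 · x ≡ x
    identityʳ : ∀ x → x · 𝟙 ≡ x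
    zeroˡ   : ∀ x → 𝟘 · x ≡ 𝟘
    zeroʳ   : ∀ x → x · 𝟘 ≡ 𝟘
    -- weak comparison monoid axioms (except the quasi-identity);
    -- an element e ∈ D(S) is written D w
    ax1  : ∀ s → (s ✱ s) · s ≡ s
    ax2  : ∀ s t → s ✱ t ≡ t ✱ s
    ax3  : ∀ s t → (s ✱ t) · s ≡ (s ✱ t) · t
    ax4  : ∀ s t u v → ((u ✱ v) · s) ✱ t ≡ (s ✱ t) · (u ✱ v)
    ax5  : ∀ s t u → u · (s ✱ t) ≡ ((u · s) ✱ (u · t)) · u
    ax6  : ∀ s t → D (s ≢ₛ t) ≡ (s ≢ₛ t)
    ax7  : ∀ s t u → s · (t ≢ₛ u) ≡ ((s · t) ≢ₛ (s · u)) · s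
    ax8  : ∀ s t → (s ✱ t) · (s ≢ₛ t) ≡ 𝟘
    ax9  : ∀ w u v → D w · (u ≢ₛ v) ≡ ((D w · u) ≢ₛ (D w · v))
    ax10 : ∀ s t u v → (s ✱ t) · cmp s t u v ≡ (s ✱ t) · u
    ax11 : ∀ s t u v → (s ≢ₛ t) · cmp s t u v ≡ (s ≢ₛ t) · v
    ax12 : ∀ s t u v → D (cmp s t u v) ≼ (D s · D t)

  QuasiIdentity : Set ℓ
  QuasiIdentity = ∀ s t w → (s ✱ t) ≼ D w → (s ≢ₛ t) ≼ D w → (D s · D t) ≼ D w

  Identities : Set ℓ
  Identities =
    (∀ s t u → cmp s t u u ≡ D s · D t · u) ×
    (∀ s t u v → cmp s t u v ≡ cmp s t ((s ✱ t) · u) ((s ≢ₛ t) · v))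

-- By ax12 every value (s = t)[u, v] lies under D(s)D(t). The quasi-identity turns into a
-- separation principle: two elements x, y under D(s)D(t) that are equal after
-- multiplying by s * t and by s ≠ t are equal. Indeed, for a projection r with
-- r x = r y one gets r D(x) ≤ x * y; applying the quasi-identity to D(x)s, D(x)t
-- yields D(x) ≤ x * y, symmetrically D(y) ≤ x * y, hence x * y = D(x) = D(y) and
-- x = (x * y) x = (x * y) y = y. Both identities are instances of separation, and
-- conversely the identities compute D(s)D(t) = (s = t)[s * t, s ≠ t] ≤ e.
module Submission where

open import Defs
open import Level using (Level)
open import Data.Product using (_,_)
open import Function.Bundles using (_⇔_; mk⇔)
open import Relation.Binary.PropositionalEquality

module Properties {ℓ : Level} (M : PreWCM ℓ) where
  open PreWCM M
  open ≡-Reasoning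

  IsProjection : S → Set ℓ
  IsProjection e = e ≡ D e

  D-𝟙 : D 𝟙 ≡ 𝟙
  D-𝟙 = trans (sym (identityʳ _)) (ax1 𝟙)

  ✱-restrictˡ : ∀ s t → s ✱ t ≡ (s ✱ t) · D s
  ✱-restrictˡ s t = begin
    s ✱ t             ≡⟨ cong (_✱ t) (sym (ax1 s)) ⟩
    ((s ✱ s) · s) ✱ t ≡⟨ ax4 s t s s ⟩
    (s ✱ t) · D s     ∎

  ✱-restrictʳ : ∀ s t → s ✱ t ≡ (s ✱ t) · D t
  ✱-restrictʳ s t = begin
    s ✱ t         ≡⟨ ax2 s t ⟩
    t ✱ s         ≡⟨ ✱-restrictˡ t s ⟩
    (t ✱ s) · D t ≡⟨ cong (_· D t) (ax2 t s) ⟩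
    (s ✱ t) · D t ∎

  ✱-idem : ∀ s t → (s ✱ t) · (s ✱ t) ≡ s ✱ t
  ✱-idem s t = trans (ax10 s t 𝟙 𝟘) (identityʳ _)

  ✱-✱ : ∀ u v a b → (u ✱ v) ✱ (a ✱ b) ≡ (a ✱ b) · (u ✱ v)
  ✱-✱ u v a b = begin
    (u ✱ v) ✱ (a ✱ b)        ≡⟨ cong (_✱ (a ✱ b)) (sym (identityʳ _)) ⟩
    ((u ✱ v) · 𝟙) ✱ (a ✱ b)  ≡⟨ ax4 𝟙 (a ✱ b) u v ⟩
    (𝟙 ✱ (a ✱ b)) · (u ✱ v)  ≡⟨ cong (_· (u ✱ v)) (trans (ax2 𝟙 (a ✱ b)) ✱-✱𝟙) ⟩
    (a ✱ b) · (u ✱ v)        ∎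
    where
    ✱-✱𝟙 : (a ✱ b) ✱ 𝟙 ≡ a ✱ b
    ✱-✱𝟙 = begin
      (a ✱ b) ✱ 𝟙        ≡⟨ cong (_✱ 𝟙) (sym (identityʳ _)) ⟩
      ((a ✱ b) · 𝟙) ✱ 𝟙  ≡⟨ ax4 𝟙 𝟙 a b ⟩
      D 𝟙 · (a ✱ b)      ≡⟨ cong (_· (a ✱ b)) D-𝟙 ⟩
      𝟙 · (a ✱ b)        ≡⟨ identityˡ _ ⟩
      a ✱ b              ∎

  ✱-isProjection : ∀ s t → IsProjection (s ✱ t)
  ✱-isProjection s t = sym (trans (✱-✱ s t s t) (✱-idem s t))

  D-isProjection : ∀ s → IsProjection (D s)
  D-isProjection s = ✱-isProjection s s

  ≢-isProjection : ∀ s t → IsProjection (s ≢ₛ t)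
  ≢-isProjection s t = sym (ax6 s t)

  projection-idem : ∀ {e} → IsProjection e → e · e ≡ e
  projection-idem {e} pe = subst (λ z → z · z ≡ z) (sym pe) (✱-idem e e)

  projection-comm : ∀ {e f} → IsProjection e → IsProjection f → e · f ≡ f · e
  projection-comm {e} {f} pe pf =
    subst₂ (λ a b → a · b ≡ b · a) (sym pe) (sym pf)
      (trans (sym (✱-✱ f f e e)) (trans (ax2 _ _) (✱-✱ e e f f)))

  ·-isProjection : ∀ {e f} → IsProjection e → IsProjection f → IsProjection (e · f)
  ·-isProjection {e} {f} pe pf = trans e·f≡ (trans (✱-isProjection _ _) (cong D (sym e·f≡)))
    where
    e·f≡ : e · f ≡ D f ✱ D e
    e·f≡ = trans (cong₂ _·_ pe pf) (sym (✱-✱ f f e e))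

  ≼-antisym : ∀ {e f} → IsProjection e → IsProjection f → e ≼ f → f ≼ e → e ≡ f
  ≼-antisym pe pf e≼f f≼e = trans e≼f (trans (projection-comm pe pf) (sym f≼e))

  DsDt-isProjection : ∀ s t → IsProjection (D s · D t)
  DsDt-isProjection s t = ·-isProjection (D-isProjection s) (D-isProjection t)

  projection-✱ : ∀ {e} → IsProjection e → ∀ s t → (e · s) ✱ t ≡ (s ✱ t) · e
  projection-✱ {e} pe s t = subst (λ z → (z · s) ✱ t ≡ (s ✱ t) · z) (sym pe) (ax4 s t e e)

  D-projection-· : ∀ {e} → IsProjection e → ∀ s → D (e · s) ≡ e · D s
  D-projection-· {e} pe s = sym (begin
    e · D s                 ≡⟨ subst (λ z → z · D s ≡ D (z · s) · z) (sym pe) (ax5 s s (D e)) ⟩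
    D (e · s) · e           ≡⟨ cong (_· e) (projection-✱ pe s (e · s)) ⟩
    (s ✱ (e · s)) · e · e   ≡⟨ assoc _ e e ⟩
    (s ✱ (e · s)) · (e · e) ≡⟨ cong ((s ✱ (e · s)) ·_) (projection-idem pe) ⟩
    (s ✱ (e · s)) · e       ≡⟨ sym (projection-✱ pe s (e · s)) ⟩
    D (e · s)               ∎)

  ✱-projection-· : ∀ {e} → IsProjection e → ∀ s t → (e · s) ✱ (e · t) ≡ e · (s ✱ t)
  ✱-projection-· {e} pe s t = sym (trans (ax5 s t e) h·e≡h)
    where
    h = (e · s) ✱ (e · t)
    h≡ : h ≡ h · (e · D s)
    h≡ = trans (✱-restrictˡ (e · s) (e · t)) (cong (h ·_) (D-projection-· pe s))
    h·e≡h : h · e ≡ h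
    h·e≡h = begin
      h · e               ≡⟨ cong (_· e) h≡ ⟩
      h · (e · D s) · e   ≡⟨ assoc h _ e ⟩
      h · (e · D s · e)   ≡⟨ cong (λ z → h · (z · e)) (projection-comm pe (D-isProjection s)) ⟩
      h · (D s · e · e)   ≡⟨ cong (h ·_) (assoc (D s) e e) ⟩
      h · (D s · (e · e)) ≡⟨ cong (λ z → h · (D s · z)) (projection-idem pe) ⟩
      h · (D s · e)       ≡⟨ cong (h ·_) (projection-comm (D-isProjection s) pe) ⟩
      h · (e · D s)       ≡⟨ sym h≡ ⟩
      h                   ∎

  ≢-projection-· : ∀ {e} → IsProjection e → ∀ s t → (e · s) ≢ₛ (e · t) ≡ e · (s ≢ₛ t)
  ≢-projection-· {e} pe s t =
    subst (λ z → (z · s) ≢ₛ (z · t) ≡ z · (s ≢ₛ t)) (sym pe) (sym (ax9 e s t))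

  fixed⇒D≼ : ∀ {f} → IsProjection f → ∀ x → x ≡ f · x → D x ≼ f
  fixed⇒D≼ {f} pf x x≡fx = begin
    D x       ≡⟨ cong D x≡fx ⟩
    D (f · x) ≡⟨ D-projection-· pf x ⟩
    f · D x   ≡⟨ projection-comm pf (D-isProjection x) ⟩
    D x · f   ∎

  D≼⇒fixed : ∀ {f} → IsProjection f → ∀ x → D x ≼ f → x ≡ f · x
  D≼⇒fixed {f} pf x Dx≼f = begin
    x             ≡⟨ sym (ax1 x) ⟩
    D x · x       ≡⟨ cong (_· x) Dx≼f ⟩
    D x · f · x   ≡⟨ cong (_· x) (projection-comm (D-isProjection x) pf) ⟩
    f · D x · x   ≡⟨ assoc f (D x) x ⟩
    f · (D x · x) ≡⟨ cong (f ·_) (ax1 x) ⟩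
    f · x         ∎

  cmp-fixed : ∀ s t u v → cmp s t u v ≡ (D s · D t) · cmp s t u v
  cmp-fixed s t u v = D≼⇒fixed (DsDt-isProjection s t) (cmp s t u v) (ax12 s t u v)

  ✱≼DsDt : ∀ s t → (s ✱ t) ≼ (D s · D t)
  ✱≼DsDt s t = trans (✱-restrictʳ s t) (trans (cong (_· D t) (✱-restrictˡ s t)) (assoc _ _ _))

  ≢≼DsDt : ∀ s t → (s ≢ₛ t) ≼ (D s · D t)
  ≢≼DsDt s t = trans (sym (ax6 s t)) (trans (ax12 s t 𝟘 𝟙) (cong (_· (D s · D t)) (ax6 s t)))

  agree⇒≼✱ : ∀ {r} → IsProjection r → ∀ x y → r · x ≡ r · y → (r · D x) ≼ (x ✱ y)
  agree⇒≼✱ {r} pr x y rx≡ry =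
    trans (sym w·k≡k) (projection-comm (✱-isProjection x y) pk)
    where
    k = r · D x
    pk = ·-isProjection pr (D-isProjection x)
    rDx≡rDy : r · D x ≡ r · D y
    rDx≡rDy = trans (sym (D-projection-· pr x)) (trans (cong D rx≡ry) (D-projection-· pr y))
    kx≡ky : k · x ≡ k · y
    kx≡ky = begin
      r · D x · x   ≡⟨ trans (assoc r (D x) x) (cong (r ·_) (ax1 x)) ⟩
      r · x         ≡⟨ rx≡ry ⟩
      r · y         ≡⟨ sym (trans (assoc r (D y) y) (cong (r ·_) (ax1 y))) ⟩
      r · D y · y   ≡⟨ cong (_· y) (sym rDx≡rDy) ⟩
      r · D x · y   ∎
    w·k≡k : (x ✱ y) · k ≡ k
    w·k≡k = begin
      (x ✱ y) · k     ≡⟨ sym (projection-✱ pk x y) ⟩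
      (k · x) ✱ y     ≡⟨ cong (_✱ y) kx≡ky ⟩
      (k · y) ✱ y     ≡⟨ projection-✱ pk y y ⟩
      D y · k         ≡⟨ cong (D y ·_) rDx≡rDy ⟩
      D y · (r · D y) ≡⟨ projection-comm (D-isProjection y) (·-isProjection pr (D-isProjection y)) ⟩
      r · D y · D y   ≡⟨ trans (assoc r (D y) (D y)) (cong (r ·_) (projection-idem (D-isProjection y))) ⟩
      r · D y         ≡⟨ sym rDx≡rDy ⟩
      k               ∎

  module _ (quasiIdentity : QuasiIdentity) where

    quasiIdentity-relative : ∀ s t {g e} → IsProjection g → IsProjection e →
      ((s ✱ t) · g) ≼ e → ((s ≢ₛ t) · g) ≼ e → (D s · D t · g) ≼ e
    quasiIdentity-relative s t {g} {e} pg pe ✱g≼e ≢g≼e =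
      subst (λ z → z ≼ e) DgsDgt≡ (subst (λ z → (D (g · s) · D (g · t)) ≼ z) (sym pe)
        (quasiIdentity (g · s) (g · t) e
          (subst₂ _≼_ (sym gs✱gt≡) pe ✱g≼e)
          (subst₂ _≼_ (sym gs≢gt≡) pe ≢g≼e)))
      where
      gs✱gt≡ : (g · s) ✱ (g · t) ≡ (s ✱ t) · g
      gs✱gt≡ = trans (✱-projection-· pg s t) (projection-comm pg (✱-isProjection s t))
      gs≢gt≡ : (g · s) ≢ₛ (g · t) ≡ (s ≢ₛ t) · g
      gs≢gt≡ = trans (≢-projection-· pg s t) (projection-comm pg (≢-isProjection s t))
      DgsDgt≡ : D (g · s) · D (g · t) ≡ D s · D t · g
      DgsDgt≡ = begin
        D (g · s) · D (g · t) ≡⟨ cong₂ _·_ (D-projection-· pg s) (D-projection-· pg t) ⟩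
        g · D s · (g · D t)   ≡⟨ cong (_· (g · D t)) (projection-comm pg (D-isProjection s)) ⟩
        D s · g · (g · D t)   ≡⟨ assoc (D s) g _ ⟩
        D s · (g · (g · D t)) ≡⟨ cong (D s ·_) (trans (sym (assoc g g (D t))) (cong (_· D t) (projection-idem pg))) ⟩
        D s · (g · D t)       ≡⟨ cong (D s ·_) (projection-comm pg (D-isProjection t)) ⟩
        D s · (D t · g)       ≡⟨ sym (assoc (D s) (D t) g) ⟩
        D s · D t · g         ∎

    D≼✱ : ∀ s t x y → x ≡ (D s · D t) · x →
      (s ✱ t) · x ≡ (s ✱ t) · y → (s ≢ₛ t) · x ≡ (s ≢ₛ t) · y → D x ≼ (x ✱ y)
    D≼✱ s t x y x≡fx ✱x≡✱y ≢x≡≢y =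
      subst (λ z → z ≼ (x ✱ y)) fDx≡Dx
        (quasiIdentity-relative s t (D-isProjection x) (✱-isProjection x y)
          (agree⇒≼✱ (✱-isProjection s t) x y ✱x≡✱y)
          (agree⇒≼✱ (≢-isProjection s t) x y ≢x≡≢y))
      where
      fDx≡Dx : D s · D t · D x ≡ D x
      fDx≡Dx = trans (projection-comm (DsDt-isProjection s t) (D-isProjection x))
                     (sym (fixed⇒D≼ (DsDt-isProjection s t) x x≡fx))

    separation : ∀ s t x y → x ≡ (D s · D t) · x → y ≡ (D s · D t) · y →
      (s ✱ t) · x ≡ (s ✱ t) · y → (s ≢ₛ t) · x ≡ (s ≢ₛ t) · y → x ≡ y
    separation s t x y x≡fx y≡fy ✱x≡✱y ≢x≡≢y = begin
      x           ≡⟨ sym (ax1 x) ⟩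
      D x · x     ≡⟨ cong (_· x) (sym ✱≡Dx) ⟩
      (x ✱ y) · x ≡⟨ ax3 x y ⟩
      (x ✱ y) · y ≡⟨ cong (_· y) ✱≡Dy ⟩
      D y · y     ≡⟨ ax1 y ⟩
      y           ∎
      where
      ✱≡Dx : x ✱ y ≡ D x
      ✱≡Dx = ≼-antisym (✱-isProjection x y) (D-isProjection x)
        (✱-restrictˡ x y) (D≼✱ s t x y x≡fx ✱x≡✱y ≢x≡≢y)
      ✱≡Dy : x ✱ y ≡ D y
      ✱≡Dy = ≼-antisym (✱-isProjection x y) (D-isProjection y) (✱-restrictʳ x y)
        (subst (λ z → D y ≼ z) (ax2 y x) (D≼✱ s t y x y≡fy (sym ✱x≡✱y) (sym ≢x≡≢y)))

    cmp-diagonal : ∀ s t u → cmp s t u u ≡ D s · D t · u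
    cmp-diagonal s t u = separation s t _ _ (cmp-fixed s t u u) fu≡ffu ✱-agree ≢-agree
      where
      f = D s · D t
      fu≡ffu : f · u ≡ f · (f · u)
      fu≡ffu = sym (trans (sym (assoc f f u)) (cong (_· u) (projection-idem (DsDt-isProjection s t))))
      ✱-agree : (s ✱ t) · cmp s t u u ≡ (s ✱ t) · (f · u)
      ✱-agree = trans (ax10 s t u u) (trans (cong (_· u) (✱≼DsDt s t)) (assoc _ _ _))
      ≢-agree : (s ≢ₛ t) · cmp s t u u ≡ (s ≢ₛ t) · (f · u)
      ≢-agree = trans (ax11 s t u u) (trans (cong (_· u) (≢≼DsDt s t)) (assoc _ _ _))

    cmp-restrict : ∀ s t u v → cmp s t u v ≡ cmp s t ((s ✱ t) · u) ((s ≢ₛ t) · v)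
    cmp-restrict s t u v =
      separation s t _ _ (cmp-fixed s t u v) (cmp-fixed s t _ _) ✱-agree ≢-agree
      where
      ✱-agree : (s ✱ t) · cmp s t u v ≡ (s ✱ t) · cmp s t ((s ✱ t) · u) ((s ≢ₛ t) · v)
      ✱-agree = trans (ax10 s t u v) (sym (trans (ax10 s t _ _)
        (trans (sym (assoc _ _ u)) (cong (_· u) (✱-idem s t)))))
      ≢-agree : (s ≢ₛ t) · cmp s t u v ≡ (s ≢ₛ t) · cmp s t ((s ✱ t) · u) ((s ≢ₛ t) · v)
      ≢-agree = trans (ax11 s t u v) (sym (trans (ax11 s t _ _)
        (trans (sym (assoc _ _ v)) (cong (_· v) (projection-idem (≢-isProjection s t))))))

  identities⇒quasiIdentity : Identities → QuasiIdentity
  identities⇒quasiIdentity (diagonal , restrict) s t w ✱≼e ≢≼e = begin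
    D s · D t                                ≡⟨ sym (identityʳ _) ⟩
    D s · D t · 𝟙                            ≡⟨ sym (diagonal s t 𝟙) ⟩
    cmp s t 𝟙 𝟙                              ≡⟨ restrict s t 𝟙 𝟙 ⟩
    cmp s t ((s ✱ t) · 𝟙) ((s ≢ₛ t) · 𝟙)     ≡⟨ cong₂ (cmp s t) (identityʳ _) (identityʳ _) ⟩
    cmp s t (s ✱ t) (s ≢ₛ t)                 ≡⟨ cong₂ (cmp s t) ✱≼e ≢≼e ⟩
    cmp s t ((s ✱ t) · D w) ((s ≢ₛ t) · D w) ≡⟨ sym (restrict s t (D w) (D w)) ⟩
    cmp s t (D w) (D w)                      ≡⟨ diagonal s t (D w) ⟩
    D s · D t · D w                          ∎

proposition2p21 : ∀ {ℓ : Level} (M : PreWCM ℓ) → PreWCM.QuasiIdentity M ⇔ PreWCM.Identities M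
proposition2p21 M = mk⇔ (λ qi → cmp-diagonal qi , cmp-restrict qi) identities⇒quasiIdentity
  where open Properties M
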